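{- Let $n,m\ge 1$ and $p\ge 2$ be integers and let $A$ be an $n\times m$ matrix with entries in $[p]=\{0,1,\ldots,p-1\}$. Then: (a) If $X_1,X_2,\ldots,X_s$ are $n\times n$ transposition matrices such that $$r(X_1X_2\cdots X_sA)>r(X_2X_3\cdots X_sA)>\cdots>r(X_{s-1}X_sA)>r(X_sA)>r(A),$$ then $c(X_1X_2\cdots X_sA)>c(A)$. (b) If $Y_1,Y_2,\ldots,Y_t$ are $m\times m$ transposition matrices such that $$c(AY_1Y_2\cdots Y_t)>c(AY_1Y_2\cdots Y_{t-1})>\cdots>c(AY_1Y_2)>c(AY_1)>c(A),$$ then $r(AY_1Y_2\cdots Y_t)>r(A)$.
   Context: For $A=(a_{ij})$ an $n\times m$ matrix with entries in $[p]$, put $x_i=\sum_{j=1}^m a_{ij}p^{m-j}$ ($i=1,\ldots,n$) and $y_j=\sum_{i=1}^n a_{ij}p^{n-i}$ ($j=1,\ldots,m$). Define the ordered tuples $r(A)=\langle x_1,\ldots,x_n\rangle$ and $c(A)=\langle y_1,\ldots,y_m\rangle$. Tuples of integers of the same length are compared with the lexicographic order. A transposition matrix is a matrix obtained from the identity matrix by interchanging exactly two rows; multiplying a matrix on the left by an $n\times n$ transposition swaps two of its rows, multiplying on the right by an $m\times m$ transposition swaps two of its columns. -}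

module Defs where

open import Data.Nat using (ℕ; zero; suc; _+_; _*_; _∸_; _^_; _<_; _≥_)
open import Data.Fin using (Fin; toℕ; _≟_)
open import Data.Vec using (Vec; tabulate)
open import Data.Vec.Relation.Binary.Lex.Strict using (Lex-<)
open import Data.List using (List; []; _∷_)
open import Data.Product using (_×_; Σ; ∃; _,_)
open import Data.Unit using (⊤)
open import Relation.Nullary using (yes; no; ¬_)
open import Relation.Binary.PropositionalEquality using (_≡_)

Mat : ℕ → ℕ → Set
Mat n m = Fin n → Fin m → ℕ

EntriesIn : ∀ {n m} → ℕ → Mat n m → Set
EntriesIn {n} {m} p A = ∀ (i : Fin n) (j : Fin m) → A i j < p

∑ : ∀ {k} → (Fin k → ℕ) → ℕ
∑ {zero} f = 0
∑ {suc k} f = f Fin.zero + ∑ (λ i → f (Fin.suc i))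

_⊗_ : ∀ {n k m} → Mat n k → Mat k m → Mat n m
(A ⊗ B) i j = ∑ (λ l → A i l * B l j)

I : ∀ {n} → Mat n n
I i j with i ≟ j
... | yes _ = 1
... | no _ = 0

swapIdx : ∀ {n} → Fin n → Fin n → Fin n → Fin n
swapIdx a b k with k ≟ a
... | yes _ = b
... | no _ with k ≟ b
...   | yes _ = a
...   | no _ = k

swapRows : ∀ {n} → Fin n → Fin n → Mat n n
swapRows a b k l = I (swapIdx a b k) l

IsTransposition : ∀ {n} → Mat n n → Set
IsTransposition {n} X =
  Σ (Fin n) λ a → Σ (Fin n) λ b → (¬ a ≡ b) × (∀ k l → X k l ≡ swapRows a b k l)

-- r(A) = ⟨x_1,…,x_n⟩, x_i = Σ_j a_ij p^(m-j)  (j 1-based; here 0-based j ↦ m-1-j)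
r : ∀ {n m} → ℕ → Mat n m → Vec ℕ n
r {n} {m} p A = tabulate λ i → ∑ (λ j → A i j * p ^ (m ∸ suc (toℕ j)))

c : ∀ {n m} → ℕ → Mat n m → Vec ℕ m
c {n} {m} p A = tabulate λ j → ∑ (λ i → A i j * p ^ (n ∸ suc (toℕ i)))

_<lex_ : ∀ {k} → Vec ℕ k → Vec ℕ k → Set
u <lex v = Lex-< _≡_ _<_ u v

_>lex_ : ∀ {k} → Vec ℕ k → Vec ℕ k → Set
u >lex v = v <lex u

leftProd : ∀ {n m} → List (Mat n n) → Mat n m → Mat n m
leftProd [] A = A
leftProd (X ∷ Xs) A = X ⊗ leftProd Xs A

rightProd : ∀ {n m} → Mat n m → List (Mat m m) → Mat n m
rightProd A [] = A
rightProd A (Y ∷ Ys) = rightProd (A ⊗ Y) Ys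

AllTransp : ∀ {k} → List (Mat k k) → Set
AllTransp [] = ⊤
AllTransp (X ∷ Xs) = IsTransposition X × AllTransp Xs

RowChain : ∀ {n m} → ℕ → List (Mat n n) → Mat n m → Set
RowChain p [] A = ⊤
RowChain p (X ∷ Xs) A = (r p (leftProd (X ∷ Xs) A) >lex r p (leftProd Xs A)) × RowChain p Xs A

ColChain : ∀ {n m} → ℕ → Mat n m → List (Mat m m) → Set
ColChain p A [] = ⊤
ColChain p A (Y ∷ Ys) = (c p (A ⊗ Y) >lex c p A) × ColChain p (A ⊗ Y) Ys

{-# OPTIONS --safe #-}
module Submission where

-- Reading the rows of a matrix as base-p numerals, the lexicographic order on
-- r(A) is decided at the first row i where the two matrices differ.  If the
-- matrices differ by swapping rows x and y, that row is the smaller of x, y,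
-- say x, and numerically row x of A is smaller than row y.  Base-p digits
-- compare like numerals, so there is a first column j where row x of A has a
-- smaller digit than row y, and the two rows agree before j.  Hence columns
-- before j are unchanged by the swap, and column j increases already at row x
-- with the rows above x untouched: c increases as well.  A chain of
-- transpositions increasing r therefore increases c at every step, and part (b)
-- is part (a) for the transposed matrix.

open import Defs
open import Data.Nat using (ℕ; zero; suc; _+_; _*_; _∸_; _^_; _<_; _≥_; s≤s; z≤n)
open import Data.Nat.Properties
  using (<-cmp; <-irrefl; <-≤-trans; ≤-trans; <-asym; +-comm; +-identityʳ; *-comm; *-monoˡ-≤; m≤m+n;
         +-monoʳ-<; +-cancelˡ-<; <-isStrictPartialOrder; module ≤-Reasoning)
open import Data.Fin as Fin using (Fin; toℕ; _≟_) renaming (zero to fzero; suc to fsuc)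
open import Data.Fin.Properties as Fin using (suc-injective; <⇒≢)
open import Data.Vec using (tabulate)
import Data.Vec.Relation.Binary.Lex.Strict as Lex
open import Data.List using (List; []; _∷_)
open import Data.Product using (_×_; ∃-syntax; _,_; proj₁; proj₂)
open import Data.Empty using (⊥-elim)
open import Function using (_∘_)
open import Relation.Nullary using (yes; no)
open import Relation.Binary.Definitions using (Transitive; tri<; tri≈; tri>)
open import Relation.Binary.Structures using (IsStrictPartialOrder)
open import Relation.Binary.PropositionalEquality
  using (_≡_; _≢_; refl; sym; trans; cong; cong₂; subst)

∑-cong : ∀ {k} {f g : Fin k → ℕ} → (∀ i → f i ≡ g i) → ∑ f ≡ ∑ g
∑-cong {zero}  f≗g = refl
∑-cong {suc k} f≗g = cong₂ _+_ (f≗g fzero) (∑-cong (f≗g ∘ fsuc))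

∑-zero : ∀ k → ∑ {k} (λ _ → 0) ≡ 0
∑-zero zero    = refl
∑-zero (suc k) = ∑-zero k

I-cong : ∀ {n k} {a b : Fin n} {c d : Fin k} → (a ≡ b → c ≡ d) → (c ≡ d → a ≡ b) → I a b ≡ I c d
I-cong {a = a} {b} {c} {d} to from with a ≟ b | c ≟ d
... | yes _   | yes _   = refl
... | yes a≡b | no c≢d  = ⊥-elim (c≢d (to a≡b))
... | no a≢b  | yes c≡d = ⊥-elim (a≢b (from c≡d))
... | no _    | no _    = refl

∑-I : ∀ {k} (t : Fin k) (f : Fin k → ℕ) → ∑ (λ l → I t l * f l) ≡ f t
∑-I {suc k} fzero f =
  trans (cong₂ _+_ (+-identityʳ (f fzero)) (∑-zero k)) (+-identityʳ (f fzero))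
∑-I {suc k} (fsuc t) f =
  trans (∑-cong (λ l → cong (_* f (fsuc l)) (I-cong {a = fsuc t} {fsuc l} suc-injective (cong fsuc))))
        (∑-I t (f ∘ fsuc))

Digits : ∀ {m} → ℕ → (Fin m → ℕ) → Set
Digits p u = ∀ j → u j < p

fromDigits : ∀ {m} → ℕ → (Fin m → ℕ) → ℕ
fromDigits {m} p u = ∑ (λ j → u j * p ^ (m ∸ suc (toℕ j)))

fromDigits-cong : ∀ {m} p {u v : Fin m → ℕ} → (∀ j → u j ≡ v j) → fromDigits p u ≡ fromDigits p v
fromDigits-cong p u≗v = ∑-cong (λ j → cong (_* _) (u≗v j))

fromDigits<p^m : ∀ {m} p {u : Fin m → ℕ} → Digits p u → fromDigits p u < p ^ m

fromDigits<suc-head : ∀ {m} p {u : Fin (suc m) → ℕ} → Digits p (u ∘ fsuc) →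
                      fromDigits p u < suc (u fzero) * p ^ m
fromDigits<suc-head {m} p {u} d = begin-strict
  u fzero * p ^ m + fromDigits p (u ∘ fsuc) <⟨ +-monoʳ-< _ (fromDigits<p^m p d) ⟩
  u fzero * p ^ m + p ^ m                   ≡⟨ +-comm (u fzero * p ^ m) (p ^ m) ⟩
  suc (u fzero) * p ^ m                     ∎
  where open ≤-Reasoning

fromDigits<p^m {zero}  p d = s≤s z≤n
fromDigits<p^m {suc m} p {u} d = <-≤-trans (fromDigits<suc-head p {u} (d ∘ fsuc)) (*-monoˡ-≤ (p ^ m) (d fzero))

fromDigits-head< : ∀ {m} p {u v : Fin (suc m) → ℕ} → Digits p u → u fzero < v fzero →
                   fromDigits p u < fromDigits p v
fromDigits-head< {m} p {u} d u₀<v₀ =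
  <-≤-trans (fromDigits<suc-head p {u} (d ∘ fsuc)) (≤-trans (*-monoˡ-≤ (p ^ m) u₀<v₀) (m≤m+n _ _))

infix 4 _<lexᶠ_

_<lexᶠ_ : ∀ {k} → (Fin k → ℕ) → (Fin k → ℕ) → Set
_<lexᶠ_ {k} u v = ∃[ i ] (∀ l → l Fin.< i → u l ≡ v l) × u i < v i

<lexᶠ-cons : ∀ {k} {u v : Fin (suc k) → ℕ} → u fzero ≡ v fzero →
             u ∘ fsuc <lexᶠ v ∘ fsuc → u <lexᶠ v
<lexᶠ-cons {u = u} {v} u₀≡v₀ (i , before , uᵢ<vᵢ) = fsuc i , before′ , uᵢ<vᵢ
  where
  before′ : ∀ l → l Fin.< fsuc i → u l ≡ v l
  before′ fzero    _       = u₀≡v₀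
  before′ (fsuc l) (s≤s l<i) = before l l<i

<lexᶠ-tail : ∀ {k} {u v : Fin (suc k) → ℕ} {i} → (∀ l → l Fin.< fsuc i → u l ≡ v l) →
             u (fsuc i) < v (fsuc i) → u ∘ fsuc <lexᶠ v ∘ fsuc
<lexᶠ-tail before uᵢ<vᵢ = _ , (λ l l<i → before (fsuc l) (s≤s l<i)) , uᵢ<vᵢ

<lex⇒<lexᶠ : ∀ {k} {u v : Fin k → ℕ} → tabulate u <lex tabulate v → u <lexᶠ v
<lex⇒<lexᶠ (Lex.this u₀<v₀ _) = fzero , (λ _ ()) , u₀<v₀
<lex⇒<lexᶠ (Lex.next u₀≡v₀ t) = <lexᶠ-cons u₀≡v₀ (<lex⇒<lexᶠ t)

<lexᶠ⇒<lex : ∀ {k} {u v : Fin k → ℕ} → u <lexᶠ v → tabulate u <lex tabulate v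
<lexᶠ⇒<lex (fzero  , _ , u₀<v₀)      = Lex.this u₀<v₀ refl
<lexᶠ⇒<lex (fsuc i , before , uᵢ<vᵢ) =
  Lex.next (before fzero (s≤s z≤n)) (<lexᶠ⇒<lex (<lexᶠ-tail before uᵢ<vᵢ))

<lex-trans : ∀ {k} → Transitive (_<lex_ {k})
<lex-trans = IsStrictPartialOrder.trans (Lex.<-isStrictPartialOrder <-isStrictPartialOrder)

<lexᶠ⇒fromDigits< : ∀ {m} p {u v : Fin m → ℕ} → Digits p u → u <lexᶠ v → fromDigits p u < fromDigits p v
<lexᶠ⇒fromDigits< {suc m} p {u} {v} d (fzero , _ , u₀<v₀) = fromDigits-head< p {u} {v} d u₀<v₀
<lexᶠ⇒fromDigits< {suc m} p {u} {v} d (fsuc i , before , uᵢ<vᵢ)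
  rewrite before fzero (s≤s z≤n) =
  +-monoʳ-< (v fzero * p ^ m) (<lexᶠ⇒fromDigits< p (d ∘ fsuc) (<lexᶠ-tail before uᵢ<vᵢ))

fromDigits<⇒<lexᶠ : ∀ {m} p {u v : Fin m → ℕ} → Digits p u → Digits p v →
                    fromDigits p u < fromDigits p v → u <lexᶠ v
fromDigits<⇒<lexᶠ {zero}  p du dv ()
fromDigits<⇒<lexᶠ {suc m} p {u} {v} du dv u<v with <-cmp (u fzero) (v fzero)
... | tri< u₀<v₀ _ _ = fzero , (λ _ ()) , u₀<v₀
... | tri> _ _ v₀<u₀ = ⊥-elim (<-asym u<v (fromDigits-head< p {v} {u} dv v₀<u₀))
... | tri≈ _ u₀≡v₀ _ = <lexᶠ-cons u₀≡v₀
  (fromDigits<⇒<lexᶠ p (du ∘ fsuc) (dv ∘ fsuc)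
    (+-cancelˡ-< (v fzero * p ^ m) _ _ (subst (λ a → a * p ^ m + _ < _) u₀≡v₀ u<v)))

record Swaps {n} (s : Fin n → Fin n) (x y : Fin n) : Set where
  field
    distinct     : x ≢ y
    sends-x      : s x ≡ y
    sends-y      : s y ≡ x
    fixes-others : ∀ i → i ≢ x → i ≢ y → s i ≡ i

Swaps-sym : ∀ {n} {s : Fin n → Fin n} {x y} → Swaps s x y → Swaps s y x
Swaps-sym sw = record
  { distinct     = distinct ∘ sym
  ; sends-x      = sends-y
  ; sends-y      = sends-x
  ; fixes-others = λ i i≢y i≢x → fixes-others i i≢x i≢y
  }
  where open Swaps sw

Swaps-invariant : ∀ {n} {A : Set} {s : Fin n → Fin n} {x y} → Swaps s x y →
                  (f : Fin n → A) → f x ≡ f y → ∀ i → f (s i) ≡ f i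
Swaps-invariant {s = s} {x} {y} sw f fx≡fy i with i ≟ x | i ≟ y
... | yes refl | _        = trans (cong f sends-x) (sym fx≡fy)
  where open Swaps sw
... | no _     | yes refl = trans (cong f sends-y) fx≡fy
  where open Swaps sw
... | no i≢x   | no i≢y   = cong f (Swaps.fixes-others sw i i≢x i≢y)

Swaps-involutive : ∀ {n} {s : Fin n → Fin n} {x y} → Swaps s x y → ∀ i → s (s i) ≡ i
Swaps-involutive {s = s} {x} {y} sw i with i ≟ x | i ≟ y
... | yes refl | _        = trans (cong s sends-x) sends-y
  where open Swaps sw
... | no _     | yes refl = trans (cong s sends-y) sends-x
  where open Swaps sw
... | no i≢x   | no i≢y   = trans (cong s fixes-i) fixes-i
  where fixes-i = Swaps.fixes-others sw i i≢x i≢y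

swapIdx-swaps : ∀ {n} {a b : Fin n} → a ≢ b → Swaps (swapIdx a b) a b
swapIdx-swaps {a = a} {b} a≢b = record
  { distinct = a≢b ; sends-x = sends-a ; sends-y = sends-b ; fixes-others = fixes }
  where
  sends-a : swapIdx a b a ≡ b
  sends-a with a ≟ a
  ... | yes _   = refl
  ... | no a≢a = ⊥-elim (a≢a refl)

  sends-b : swapIdx a b b ≡ a
  sends-b with b ≟ a
  ... | yes b≡a = ⊥-elim (a≢b (sym b≡a))
  ... | no _ with b ≟ b
  ...   | yes _   = refl
  ...   | no b≢b = ⊥-elim (b≢b refl)

  fixes : ∀ i → i ≢ a → i ≢ b → swapIdx a b i ≡ i
  fixes i i≢a i≢b with i ≟ a
  ... | yes i≡a = ⊥-elim (i≢a i≡a)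
  ... | no _ with i ≟ b
  ...   | yes i≡b = ⊥-elim (i≢b i≡b)
  ...   | no _    = refl

IsTransposition⇒Swaps : ∀ {n} {X : Mat n n} → IsTransposition X →
  ∃[ s ] ∃[ x ] ∃[ y ] Swaps s x y × (∀ k l → X k l ≡ I (s k) l)
IsTransposition⇒Swaps (a , b , a≢b , X≡) = swapIdx a b , a , b , swapIdx-swaps a≢b , X≡

transposition-⊗ˡ : ∀ {n m} {s : Fin n → Fin n} {x y} (X : Mat n n) (M : Mat n m) →
  Swaps s x y → (∀ k l → X k l ≡ I (s k) l) → ∀ i j → (X ⊗ M) i j ≡ M (s i) j
transposition-⊗ˡ {s = s} X M _ X≡ i j =
  trans (∑-cong (λ l → cong (_* M l j) (X≡ i l))) (∑-I (s i) (λ l → M l j))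

transposition-⊗ʳ : ∀ {n m} {s : Fin m → Fin m} {x y} (M : Mat n m) (Y : Mat m m) →
  Swaps s x y → (∀ k l → Y k l ≡ I (s k) l) → ∀ i j → (M ⊗ Y) i j ≡ M i (s j)
transposition-⊗ʳ {s = s} M Y sw Y≡ i j =
  trans (∑-cong (λ l → trans (*-comm (M i l) (Y l j)) (cong (_* M i l) (Y≗ l))))
        (∑-I (s j) (M i))
  where
  Y≗ : ∀ l → Y l j ≡ I (s j) l
  Y≗ l = trans (Y≡ l j) (I-cong (λ sl≡j → trans (cong s (sym sl≡j)) (Swaps-involutive sw l))
                                (λ sj≡l → trans (cong s (sym sj≡l)) (Swaps-involutive sw j)))

_ᵀ : ∀ {n m} → Mat n m → Mat m n
(M ᵀ) j i = M i j

rowValues : ∀ {n m} → ℕ → Mat n m → Fin n → ℕ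
rowValues p M i = fromDigits p (M i)

module _ {n m p : ℕ} {M B : Mat n m} {s : Fin n → Fin n}
         (digits : EntriesIn p M) (B≡ : ∀ i j → B i j ≡ M (s i) j) where

  private
    rowM = rowValues p M
    rowB = rowValues p B
    colM = rowValues p (M ᵀ)
    colB = rowValues p (B ᵀ)

    rowB≡ : ∀ i → rowB i ≡ rowM (s i)
    rowB≡ i = fromDigits-cong p (B≡ i)

  swapRows-firstDiffAt : ∀ {x y} → Swaps s x y → (∀ k → k Fin.< x → rowM k ≡ rowB k) →
                         rowM x < rowB x → colM <lexᶠ colB
  swapRows-firstDiffAt {x} {y} sw before rowMx<rowBx = j , colsBefore , colAt
    where
    open Swaps sw

    rowMx<rowMy : rowM x < rowM y
    rowMx<rowMy = subst (rowM x <_) (trans (rowB≡ x) (cong rowM sends-x)) rowMx<rowBx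

    x<y : x Fin.< y
    x<y with Fin.<-cmp x y
    ... | tri< x<y _ _ = x<y
    ... | tri≈ _ x≡y _ = ⊥-elim (distinct x≡y)
    ... | tri> _ _ y<x = ⊥-elim (<-irrefl (sym rowMy≡rowMx) rowMx<rowMy)
      where rowMy≡rowMx = trans (before y y<x) (trans (rowB≡ y) (cong rowM sends-y))

    rowDiff : M x <lexᶠ M y
    rowDiff = fromDigits<⇒<lexᶠ p (digits x) (digits y) rowMx<rowMy

    j = proj₁ rowDiff

    colsBefore : ∀ j′ → j′ Fin.< j → colM j′ ≡ colB j′
    colsBefore j′ j′<j = fromDigits-cong p λ i →
      sym (trans (B≡ i j′) (Swaps-invariant sw (λ k → M k j′) (proj₁ (proj₂ rowDiff) j′ j′<j) i))

    colAt : colM j < colB j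
    colAt = <lexᶠ⇒fromDigits< p (λ i → digits i j) (x , above , Mxj<Bxj)
      where
      above : ∀ k → k Fin.< x → M k j ≡ B k j
      above k k<x = sym (trans (B≡ k j) (cong (λ i → M i j)
        (fixes-others k (<⇒≢ k<x) (<⇒≢ (Fin.<-trans k<x x<y)))))

      Mxj<Bxj : M x j < B x j
      Mxj<Bxj = subst (M x j <_) (sym (trans (B≡ x j) (cong (λ i → M i j) sends-x)))
                      (proj₂ (proj₂ rowDiff))

  swapRows-<lexᶠ : ∀ {x y} → Swaps s x y → rowM <lexᶠ rowB → colM <lexᶠ colB
  swapRows-<lexᶠ {x} {y} sw (i , before , rowMi<rowBi) with i ≟ x | i ≟ y
  ... | yes refl | _        = swapRows-firstDiffAt sw before rowMi<rowBi
  ... | no _     | yes refl = swapRows-firstDiffAt (Swaps-sym sw) before rowMi<rowBi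
  ... | no i≢x   | no i≢y   = ⊥-elim (<-irrefl rowMi≡rowBi rowMi<rowBi)
    where rowMi≡rowBi = sym (trans (rowB≡ i) (cong rowM (Swaps.fixes-others sw i i≢x i≢y)))

  swapRows-<lex : ∀ {x y} → Swaps s x y → r p M <lex r p B → c p M <lex c p B
  swapRows-<lex sw r< = <lexᶠ⇒<lex (swapRows-<lexᶠ sw (<lex⇒<lexᶠ {u = rowM} {v = rowB} r<))

EntriesIn-⊗ˡ : ∀ {n m p} {X : Mat n n} {M : Mat n m} → IsTransposition X →
               EntriesIn p M → EntriesIn p (X ⊗ M)
EntriesIn-⊗ˡ {X = X} {M} tX digits i j with IsTransposition⇒Swaps tX
... | s , _ , _ , sw , X≡ =
  subst (_< _) (sym (transposition-⊗ˡ X M sw X≡ i j)) (digits (s i) j)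

EntriesIn-⊗ʳ : ∀ {n m p} {M : Mat n m} {Y : Mat m m} → IsTransposition Y →
               EntriesIn p M → EntriesIn p (M ⊗ Y)
EntriesIn-⊗ʳ {M = M} {Y} tY digits i j with IsTransposition⇒Swaps tY
... | s , _ , _ , sw , Y≡ =
  subst (_< _) (sym (transposition-⊗ʳ M Y sw Y≡ i j)) (digits i (s j))

transposition-r<⇒c< : ∀ {n m p} {X : Mat n n} {M : Mat n m} → EntriesIn p M →
  IsTransposition X → r p M <lex r p (X ⊗ M) → c p M <lex c p (X ⊗ M)
transposition-r<⇒c< {X = X} {M} digits tX with IsTransposition⇒Swaps tX
... | _ , _ , _ , sw , X≡ = swapRows-<lex digits (transposition-⊗ˡ X M sw X≡) sw

-- c p M is r p (M ᵀ) by definition, so a column swap is a row swap of the transpose.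
transposition-c<⇒r< : ∀ {n m p} {M : Mat n m} {Y : Mat m m} → EntriesIn p M →
  IsTransposition Y → c p M <lex c p (M ⊗ Y) → r p M <lex r p (M ⊗ Y)
transposition-c<⇒r< {M = M} {Y} digits tY with IsTransposition⇒Swaps tY
... | _ , _ , _ , sw , Y≡ =
  swapRows-<lex (λ j i → digits i j) (λ j i → transposition-⊗ʳ M Y sw Y≡ i j) sw

EntriesIn-leftProd : ∀ {n m p} {A : Mat n m} (Xs : List (Mat n n)) → AllTransp Xs →
                     EntriesIn p A → EntriesIn p (leftProd Xs A)
EntriesIn-leftProd []       _          digits = digits
EntriesIn-leftProd (X ∷ Xs) (tX , tXs) digits = EntriesIn-⊗ˡ tX (EntriesIn-leftProd Xs tXs digits)

rowChain⇒c< : ∀ {n m p} {A : Mat n m} → EntriesIn p A →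
  (X : Mat n n) (Xs : List (Mat n n)) → AllTransp (X ∷ Xs) → RowChain p (X ∷ Xs) A →
  c p A <lex c p (leftProd (X ∷ Xs) A)
rowChain⇒c< digits X []        (tX , _)   (r< , _)   = transposition-r<⇒c< digits tX r<
rowChain⇒c< digits X (X′ ∷ Xs) (tX , tXs) (r< , r<s) =
  <lex-trans (rowChain⇒c< digits X′ Xs tXs r<s)
             (transposition-r<⇒c< (EntriesIn-leftProd (X′ ∷ Xs) tXs digits) tX r<)

colChain⇒r< : ∀ {n m p} {A : Mat n m} → EntriesIn p A →
  (Y : Mat m m) (Ys : List (Mat m m)) → AllTransp (Y ∷ Ys) → ColChain p A (Y ∷ Ys) →
  r p A <lex r p (rightProd A (Y ∷ Ys))
colChain⇒r< digits Y []        (tY , _)   (c< , _)   = transposition-c<⇒r< digits tY c<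
colChain⇒r< digits Y (Y′ ∷ Ys) (tY , tYs) (c< , c<s) =
  <lex-trans (transposition-c<⇒r< digits tY c<)
             (colChain⇒r< (EntriesIn-⊗ʳ tY digits) Y′ Ys tYs c<s)

theorem2 : (n m p : ℕ) → n ≥ 1 → m ≥ 1 → p ≥ 2 → (A : Mat n m) → EntriesIn p A →
    ((X : Mat n n) (Xs : List (Mat n n)) → AllTransp (X ∷ Xs) → RowChain p (X ∷ Xs) A →
      c p (leftProd (X ∷ Xs) A) >lex c p A)
  × ((Y : Mat m m) (Ys : List (Mat m m)) → AllTransp (Y ∷ Ys) → ColChain p A (Y ∷ Ys) →
      r p (rightProd A (Y ∷ Ys)) >lex r p A)
theorem2 n m p _ _ _ A digits = rowChain⇒c< digits , colChain⇒r< digits
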